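{- Let $G$ be a connected $4K_1$-free graph. Then $G$ has a Hamiltonian path if and only if (a) for every articulation point $x$ of $G$, the graph $G-\{x\}$ has exactly 2 connected components, and (b) there are no 3 articulation points of $G$ inducing a triangle in $G$. Moreover, if $G$ does not have a Hamiltonian path, then $G$ has a path cover of size 2 (i.e., $V(G)$ can be covered by two vertex-disjoint paths).
   Context: Graphs are finite, simple and undirected. $4K_1$-free means no independent set of size 4. An articulation point is a vertex $x$ such that $G-\{x\}$ is disconnected. A Hamiltonian path is a path containing all vertices of $G$. -}

module Defs where

open import Data.Nat using (ℕ)
open import Data.Fin using (Fin)
open import Data.Bool using (Bool; true; false)
open import Data.List using (List; []; _∷_)
open import Data.List.Membership.Propositional using (_∈_; _∉_)
open import Data.List.Relation.Unary.Unique.Propositional using (Unique)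
open import Data.Product using (Σ; ∃; ∃-syntax; _×_; _,_)
open import Data.Sum using (_⊎_)
open import Data.Empty using (⊥)
open import Data.Unit using (⊤)
open import Relation.Nullary using (¬_)
open import Relation.Binary.PropositionalEquality using (_≡_; _≢_)

record Graph (n : ℕ) : Set where
  field
    adj   : Fin n → Fin n → Bool
    sym   : ∀ u v → adj u v ≡ adj v u
    irrefl : ∀ v → adj v v ≡ false

module _ {n : ℕ} (G : Graph n) where
  open Graph G

  Adj : Fin n → Fin n → Set
  Adj u v = adj u v ≡ true

  data ReachIn (P : Fin n → Set) : Fin n → Fin n → Set where
    here : ∀ {u} → P u → ReachIn P u u
    step : ∀ {u w v} → P u → Adj u w → ReachIn P w v → ReachIn P u v

  All : Fin n → Set
  All _ = ⊤

  Minus : Fin n → Fin n → Set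
  Minus x v = v ≢ x

  Connected : Set
  Connected = Fin n × (∀ u v → ReachIn All u v)

  Articulation : Fin n → Set
  Articulation x =
    ∃[ u ] ∃[ v ] (u ≢ x × v ≢ x × ¬ ReachIn (Minus x) u v)

  -- G - {x} has exactly two connected components: there are two
  -- vertices of G - {x} in different components, and every vertex of
  -- G - {x} lies in the component of one of them.
  TwoComponentsMinus : Fin n → Set
  TwoComponentsMinus x =
    ∃[ a ] ∃[ b ] (a ≢ x × b ≢ x × ¬ ReachIn (Minus x) a b ×
      (∀ v → v ≢ x → ReachIn (Minus x) a v ⊎ ReachIn (Minus x) b v))

  FourK1Free : Set
  FourK1Free = ¬ (∃[ a ] ∃[ b ] ∃[ c ] ∃[ d ]
    (a ≢ b × a ≢ c × a ≢ d × b ≢ c × b ≢ d × c ≢ d ×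
     ¬ Adj a b × ¬ Adj a c × ¬ Adj a d × ¬ Adj b c × ¬ Adj b d × ¬ Adj c d))

  Chain : List (Fin n) → Set
  Chain []           = ⊤
  Chain (_ ∷ [])     = ⊤
  Chain (u ∷ v ∷ vs) = Adj u v × Chain (v ∷ vs)

  NonEmpty : List (Fin n) → Set
  NonEmpty []      = ⊥
  NonEmpty (_ ∷ _) = ⊤

  IsPath : List (Fin n) → Set
  IsPath p = NonEmpty p × Unique p × Chain p

  HamiltonianPath : Set
  HamiltonianPath = ∃[ p ] (IsPath p × (∀ v → v ∈ p))

  PathCover2 : Set
  PathCover2 = ∃[ p ] ∃[ q ] (IsPath p × IsPath q ×
    (∀ v → v ∈ p → v ∉ q) × (∀ v → v ∈ p ⊎ v ∈ q))

-- If G has a Hamiltonian path, cutting it at an articulation point x leaves two segments with no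
-- edge between them, so G − x has exactly two components; and of three vertices on the path the
-- middle one separates the other two, so three articulation points cannot form a triangle.
--
-- Conversely, let q = s … t be a longest path and suppose some vertex lies off q. By maximality no
-- outside vertex is adjacent to s or t, and s ≁ t; so, G being 4K₁-free, the outside vertices form a
-- clique (which together with q is a path cover) and every vertex of q not seen from outside is
-- adjacent to s or t. With Pósa rotations this forces all edges leaving q to end at a single vertex
-- x, an articulation point. Write q = L x R. An edge between L and R can only join the last vertex
-- of L to the first of R, and both are then articulation points forming a triangle with x;
-- otherwise the outside, L and R are three components of G − x.

module Submission where

open import Defs hiding (All)
open import Data.Nat using (ℕ; zero; suc; _≤_; _<_; s≤s)
open import Data.Nat.Properties using (≰⇒>; _≤?_; <⇒≱; m≤n+m)
open import Data.Fin using (Fin)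
open import Data.Fin.Properties using (_≟_; pigeonhole; <⇒≢; any?)
open import Data.Bool using (true)
import Data.Bool.Properties as Bool
open import Data.List using (List; []; _∷_; _++_; reverse; length; lookup; concatMap; map; filter; allFin)
open import Data.List.Properties
  using (++-assoc; reverse-++; unfold-reverse; reverse-selfInverse; length-++; ++-monoid)
open import Data.List.Extrema.Nat using (argmax; argmax-all; f[xs]≤f[argmax])
import Algebra.Solver.Monoid as MonoidSolver
open import Data.Unit using (tt)
open import Data.List.Membership.Propositional using (_∈_; _∉_)
open import Data.List.Membership.Propositional.Properties
  using (∈-++⁺ˡ; ∈-++⁺ʳ; ∈-++⁻; ∈-∃++; ∈-lookup; ∈-allFin; ∈-concatMap⁺; ∈-map⁺; ∈-filter⁺; ∈-filter⁻)
open import Data.List.Relation.Unary.Any using (here; there)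
import Data.List.Relation.Unary.Any as Any
open import Data.List.Relation.Unary.Any.Properties using (reverse⁺)
open import Data.List.Relation.Unary.All using (All; []; _∷_)
import Data.List.Relation.Unary.All as All
open import Data.List.Relation.Unary.All.Properties.Core using (¬Any⇒All¬; All¬⇒¬Any)
open import Data.List.Relation.Unary.Unique.Propositional using (Unique; []; _∷_)
open import Data.List.Relation.Unary.Unique.Propositional.Properties using (allFin⁺; filter⁺; Unique[x∷xs]⇒x∉xs)
import Data.List.Relation.Unary.Unique.DecPropositional as UniqueDec
import Data.List.Membership.DecPropositional as MembershipDec
open import Data.List.Relation.Binary.Permutation.Propositional
  using (_↭_; ↭-refl; ↭-sym; ↭-trans; ↭-prep; ↭-reflexive; ↭⇒↭ₛ)
open import Data.List.Relation.Binary.Permutation.Propositional.Properties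
  using (↭-length; ∈-resp-↭; ↭-reverse; ++⁺; shift; ++-commutativeMonoid)
import Algebra.Solver.CommutativeMonoid as CommutativeMonoidSolver
import Data.List.Relation.Binary.Permutation.Setoid.Properties as Permutationₛ
open import Data.Product using (∃; ∃-syntax; ∃₂; _×_; _,_; proj₁; proj₂)
open import Data.Sum using (_⊎_; inj₁; inj₂; [_,_])
open import Data.Empty using (⊥; ⊥-elim)
open import Function using (_∘_; id)
open import Function.Bundles using (_⇔_; mk⇔)
open import Relation.Nullary using (¬_; Dec; yes; no; ¬?)
open import Relation.Nullary.Decidable using (decidable-stable; _×-dec_)
open import Relation.Binary.PropositionalEquality
  using (_≡_; _≢_; refl; sym; trans; cong; subst; subst₂; ≢-sym; setoid)

module _ {A : Set} where

  Unique-∷ : ∀ {x} {xs : List A} → x ∉ xs → Unique xs → Unique (x ∷ xs)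
  Unique-∷ {xs = xs} x∉xs xs! = ¬Any⇒All¬ xs x∉xs ∷ xs!

  Unique-++⇒∉ : ∀ xs {ys : List A} {x} → Unique (xs ++ ys) → x ∈ xs → x ∉ ys
  Unique-++⇒∉ (_ ∷ xs) (x≢ ∷ _)  (here refl) x∈ys = All¬⇒¬Any x≢ (∈-++⁺ʳ xs x∈ys)
  Unique-++⇒∉ (_ ∷ xs) (_ ∷ xs!) (there x∈xs)   = Unique-++⇒∉ xs xs! x∈xs

  Unique-++⁻ʳ : ∀ xs {ys : List A} → Unique (xs ++ ys) → Unique ys
  Unique-++⁻ʳ []       ys!        = ys!
  Unique-++⁻ʳ (_ ∷ xs) (_ ∷ xs!)  = Unique-++⁻ʳ xs xs!

  Unique-++⇒≢ : ∀ xs {ys : List A} {x y} → Unique (xs ++ ys) → x ∈ xs → y ∈ ys → x ≢ y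
  Unique-++⇒≢ xs xs++ys! x∈xs y∈ys refl = Unique-++⇒∉ xs xs++ys! x∈xs y∈ys

  reverse-++-∷ : ∀ (xs : List A) x ys → reverse (xs ++ x ∷ ys) ≡ reverse ys ++ x ∷ reverse xs
  reverse-++-∷ xs x ys = trans (reverse-++ xs (x ∷ ys))
    (trans (cong (_++ reverse xs) (unfold-reverse x ys)) (++-assoc (reverse ys) (x ∷ []) (reverse xs)))

  reverse-≡-∷ʳ : ∀ {xs ys : List A} {x} → reverse xs ≡ ys ++ x ∷ [] → xs ≡ x ∷ reverse ys
  reverse-≡-∷ʳ {ys = ys} {x} eq = trans (sym (reverse-selfInverse eq)) (reverse-++ ys (x ∷ []))

  ∈∉⇒≢ : ∀ {x y} {xs : List A} → x ∈ xs → y ∉ xs → x ≢ y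
  ∈∉⇒≢ x∈xs y∉xs refl = y∉xs x∈xs

  ∉-resp-↭ : ∀ {x} {xs ys : List A} → xs ↭ ys → x ∉ ys → x ∉ xs
  ∉-resp-↭ xs↭ys x∉ys = x∉ys ∘ ∈-resp-↭ xs↭ys

  ↭-reverse-prefix : ∀ xs x {ys zs : List A} → ys ↭ zs → (x ∷ reverse xs) ++ ys ↭ xs ++ x ∷ zs
  ↭-reverse-prefix xs x ys↭zs = ↭-trans (↭-prep x (++⁺ (↭-reverse xs) ys↭zs)) (↭-sym (shift x xs _))

  Unique-resp-↭ : ∀ {xs ys : List A} → xs ↭ ys → Unique xs → Unique ys
  Unique-resp-↭ xs↭ys = Permutationₛ.Unique-resp-↭ (setoid A) (↭⇒↭ₛ xs↭ys)

  Unique⇒lookup-injective : ∀ {xs : List A} → Unique xs → ∀ {i j} → lookup xs i ≡ lookup xs j → i ≡ j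
  Unique⇒lookup-injective {_ ∷ _} _        {Fin.zero}  {Fin.zero}  _  = refl
  Unique⇒lookup-injective {_ ∷ _} (x≢ ∷ _) {Fin.zero}  {Fin.suc j} eq = ⊥-elim (All.lookup x≢ (∈-lookup j) eq)
  Unique⇒lookup-injective {_ ∷ _} (x≢ ∷ _) {Fin.suc i} {Fin.zero}  eq = ⊥-elim (All.lookup x≢ (∈-lookup i) (sym eq))
  Unique⇒lookup-injective {_ ∷ _} (_ ∷ xs!) {Fin.suc i} {Fin.suc j} eq =
    cong Fin.suc (Unique⇒lookup-injective xs! eq)

  ∈-∈-∃++ : ∀ {xs : List A} {y z} → y ∈ xs → z ∈ xs → y ≢ z →
    ∃[ B ] ∃[ C ] ∃[ D ] (xs ≡ B ++ y ∷ C ++ z ∷ D ⊎ xs ≡ B ++ z ∷ C ++ y ∷ D)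
  ∈-∈-∃++ (here refl) (here refl) y≢z = ⊥-elim (y≢z refl)
  ∈-∈-∃++ (here refl) (there z∈) _ with C , D , refl ← ∈-∃++ z∈ = [] , C , D , inj₁ refl
  ∈-∈-∃++ (there y∈) (here refl) _ with C , D , refl ← ∈-∃++ y∈ = [] , C , D , inj₂ refl
  ∈-∈-∃++ {x ∷ _} (there y∈) (there z∈) y≢z with ∈-∈-∃++ y∈ z∈ y≢z
  ... | B , C , D , inj₁ refl = x ∷ B , C , D , inj₁ refl
  ... | B , C , D , inj₂ refl = x ∷ B , C , D , inj₂ refl

  All¬-from-head : {P : A → Set} → ∀ y ys → (∀ B a b C → y ∷ ys ≡ B ++ a ∷ b ∷ C → P b → P a) →
    ¬ P y → All (¬_ ∘ P) (y ∷ ys)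
  All¬-from-head y []       _    ¬Py = ¬Py ∷ []
  All¬-from-head y (z ∷ zs) back ¬Py =
    ¬Py ∷ All¬-from-head z zs (λ B a b C eq → back (y ∷ B) a b C (cong (y ∷_) eq)) (¬Py ∘ back [] y z zs refl)

  listsOfLength≤ : List A → ℕ → List (List A)
  listsOfLength≤ U zero    = [] ∷ []
  listsOfLength≤ U (suc k) = [] ∷ concatMap (λ v → map (v ∷_) (listsOfLength≤ U k)) U

  ∈-listsOfLength≤ : ∀ {U} → (∀ v → v ∈ U) → ∀ {k} (xs : List A) → length xs ≤ k → xs ∈ listsOfLength≤ U k
  ∈-listsOfLength≤ _  {zero}  []       _            = here refl
  ∈-listsOfLength≤ _  {suc _} []       _            = here refl
  ∈-listsOfLength≤ ∈U         (x ∷ xs) (s≤s |xs|≤k) =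
    there (∈-concatMap⁺ (λ v → map (v ∷_) (listsOfLength≤ _ _))
      (Any.map (λ { refl → ∈-map⁺ (x ∷_) (∈-listsOfLength≤ ∈U xs |xs|≤k) }) (∈U x)))

Unique⇒length≤ : ∀ {n} {xs : List (Fin n)} → Unique xs → length xs ≤ n
Unique⇒length≤ {n} {xs} xs! with length xs ≤? n
... | yes |xs|≤n = |xs|≤n
... | no  |xs|≰n with i , j , i<j , eq ← pigeonhole (≰⇒> |xs|≰n) (lookup xs) =
  ⊥-elim (<⇒≢ i<j (Unique⇒lookup-injective xs! eq))

module Hamiltonicity {n : ℕ} (G : Graph n) where

  V : Set
  V = Fin n

  open UniqueDec (_≟_ {n}) using (unique?)
  open MembershipDec (_≟_ {n}) using (_∈?_)

  infix 4 _∼_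
  _∼_ : V → V → Set
  _∼_ = Adj G

  ∼-sym : ∀ {u v} → u ∼ v → v ∼ u
  ∼-sym {u} {v} u∼v = trans (Graph.sym G v u) u∼v

  ∼⇒≢ : ∀ {u v} → u ∼ v → u ≢ v
  ∼⇒≢ {u} u∼u refl with trans (sym u∼u) (Graph.irrefl G u)
  ... | ()

  _∼?_ : ∀ u v → Dec (u ∼ v)
  u ∼? v = Graph.adj G u v Bool.≟ true

  private variable
    s t a b c d u v w x y z : V
    xs ys q r L R O : List V

  module ++-Solver = MonoidSolver (++-monoid V)
  module ↭-Solver = CommutativeMonoidSolver (++-commutativeMonoid {A = V})

  -- Walks and reachability

  infixr 5 _▸_ _⟨_⟩_

  data Walk : V → V → List V → Set where
    [_]ʷ : ∀ v → Walk v v (v ∷ [])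
    _▸_  : u ∼ v → Walk v t xs → Walk u t (u ∷ xs)

  walk-head≡ : Walk s t (x ∷ xs) → s ≡ x
  walk-head≡ [ _ ]ʷ  = refl
  walk-head≡ (_ ▸ _) = refl

  walk-head∈ : Walk s t xs → s ∈ xs
  walk-head∈ [ _ ]ʷ  = here refl
  walk-head∈ (_ ▸ _) = here refl

  walk-last∈ : Walk s t xs → t ∈ xs
  walk-last∈ [ _ ]ʷ  = here refl
  walk-last∈ (_ ▸ W) = there (walk-last∈ W)

  _⟨_⟩_ : Walk s a xs → a ∼ b → Walk b t ys → Walk s t (xs ++ ys)
  [ _ ]ʷ   ⟨ a∼b ⟩ W = a∼b ▸ W
  (e ▸ W₁) ⟨ a∼b ⟩ W = e ▸ (W₁ ⟨ a∼b ⟩ W)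

  reverseʷ : Walk s t xs → Walk t s (reverse xs)
  reverseʷ [ v ]ʷ = [ v ]ʷ
  reverseʷ {xs = u ∷ xs} (u∼v ▸ W) =
    subst (Walk _ u) (sym (unfold-reverse u xs)) (reverseʷ W ⟨ ∼-sym u∼v ⟩ [ u ]ʷ)

  takeʷ : ∀ xs → Walk s t (x ∷ xs ++ ys) → ∃[ a ] Walk s a (x ∷ xs)
  takeʷ []       [ _ ]ʷ  = _ , [ _ ]ʷ
  takeʷ []       (_ ▸ _) = _ , [ _ ]ʷ
  takeʷ (_ ∷ xs) (e ▸ W) = let a , W′ = takeʷ xs W in a , e ▸ W′

  dropʷ : ∀ xs → Walk s t (xs ++ y ∷ ys) → Walk y t (y ∷ ys)
  dropʷ []           W       with refl ← walk-head≡ W = W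
  dropʷ (_ ∷ [])     (_ ▸ W) = dropʷ [] W
  dropʷ (_ ∷ _ ∷ xs) (_ ▸ W) = dropʷ (_ ∷ xs) W

  prefixʷ : ∀ xs → Walk s t (xs ++ ys) → v ∈ xs → ∃[ a ] Walk s a xs
  prefixʷ (_ ∷ xs) W _ = takeʷ xs W

  suffixʷ : ∀ xs ys → Walk s t (xs ++ ys) → v ∈ ys → ∃[ b ] Walk b t ys
  suffixʷ xs (_ ∷ _) W _ = _ , dropʷ xs W

  splitʷ : ∀ xs → Walk s t (xs ++ x ∷ y ∷ ys) → Walk s x (xs ++ x ∷ []) × x ∼ y × Walk y t (y ∷ ys)
  splitʷ []           (x∼v ▸ W) with refl ← walk-head≡ W = [ _ ]ʷ , x∼v , W
  splitʷ (_ ∷ [])     (e ▸ W)   = let W₁ , x∼y , W₂ = splitʷ [] W in e ▸ W₁ , x∼y , W₂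
  splitʷ (_ ∷ _ ∷ xs) (e ▸ W)   = let W₁ , x∼y , W₂ = splitʷ (_ ∷ xs) W in e ▸ W₁ , x∼y , W₂

  walk-single-last : Walk s t (x ∷ []) → t ≡ x
  walk-single-last [ _ ]ʷ   = refl
  walk-single-last (_ ▸ ())

  closed-walk-single : Walk s s xs → Unique xs → xs ≡ s ∷ []
  closed-walk-single [ _ ]ʷ  _         = refl
  closed-walk-single (_ ▸ W) (s≢ ∷ _)  = ⊥-elim (All¬⇒¬Any s≢ (walk-last∈ W))

  later≢head : ∀ A → Walk s t (A ++ u ∷ xs) → Unique (A ++ u ∷ xs) → v ∈ xs → v ≢ s
  later≢head []      W q! v∈xs v≡s = Unique[x∷xs]⇒x∉xs q! (subst (_∈ _) (trans v≡s (walk-head≡ W)) v∈xs)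
  later≢head (_ ∷ A) W q! v∈xs v≡s =
    Unique[x∷xs]⇒x∉xs q! (subst (_∈ _) (trans v≡s (walk-head≡ W)) (∈-++⁺ʳ A (there v∈xs)))

  earlier≢last : ∀ A → Walk s t (A ++ u ∷ xs) → Unique (A ++ u ∷ xs) → v ∈ A → v ≢ t
  earlier≢last A W q! v∈A = Unique-++⇒≢ A q! v∈A (walk-last∈ (dropʷ A W))

  walk⇒Chain : Walk s t xs → Chain G xs
  walk⇒Chain [ _ ]ʷ           = tt
  walk⇒Chain (e ▸ [ _ ]ʷ)     = e , tt
  walk⇒Chain (e ▸ W@(_ ▸ _))  = e , walk⇒Chain W

  walk⇒IsPath : Walk s t xs → Unique xs → IsPath G xs
  walk⇒IsPath W xs! = walk-nonEmpty W , xs! , walk⇒Chain W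
    where
    walk-nonEmpty : Walk s t xs → NonEmpty G xs
    walk-nonEmpty [ _ ]ʷ  = tt
    walk-nonEmpty (_ ▸ _) = tt

  IsPath⇒walk : IsPath G xs → ∃₂ λ s t → Walk s t xs
  IsPath⇒walk {x ∷ xs} (_ , _ , chain) = x , from-chain x xs chain
    where
    from-chain : ∀ x xs → Chain G (x ∷ xs) → ∃[ t ] Walk x t (x ∷ xs)
    from-chain x []       _           = x , [ x ]ʷ
    from-chain x (y ∷ xs) (x∼y , chain) = let t , W = from-chain y xs chain in t , x∼y ▸ W

  Chain? : ∀ xs → Dec (Chain G xs)
  Chain? []           = yes tt
  Chain? (_ ∷ [])     = yes tt
  Chain? (u ∷ v ∷ xs) = (u ∼? v) ×-dec Chain? (v ∷ xs)

  IsPath? : ∀ xs → Dec (IsPath G xs)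
  IsPath? []       = no proj₁
  IsPath? (x ∷ xs) = yes tt ×-dec unique? (x ∷ xs) ×-dec Chain? (x ∷ xs)

  module _ {P : V → Set} where

    reach-start : ReachIn G P u v → P u
    reach-start (here Pu)     = Pu
    reach-start (step Pu _ _) = Pu

    reach-trans : ReachIn G P u v → ReachIn G P v w → ReachIn G P u w
    reach-trans (here _)       r′ = r′
    reach-trans (step Pu e r)  r′ = step Pu e (reach-trans r r′)

    reach-sym : ReachIn G P u v → ReachIn G P v u
    reach-sym (here Pu)          = here Pu
    reach-sym (step Pu u∼w r)    = reach-trans (reach-sym r) (step (reach-start r) (∼-sym u∼w) (here Pu))

    reach-common : ReachIn G P w u → ReachIn G P w v → ReachIn G P u v
    reach-common wu wv = reach-trans (reach-sym wu) wv

    reach-closed : (S : V → Set) → (∀ {u v} → S u → P v → u ∼ v → S v) → S u → ReachIn G P u v → S v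
    reach-closed S closed Su (here _)       = Su
    reach-closed S closed Su (step _ u∼w r) = reach-closed S closed (closed Su (reach-start r) u∼w) r

    walk-reach : Walk s t xs → (∀ {v} → v ∈ xs → P v) → u ∈ xs → v ∈ xs → ReachIn G P u v
    walk-reach W P-on u∈ v∈ = reach-common (from-head W P-on u∈) (from-head W P-on v∈)
      where
      from-head : Walk s t xs → (∀ {v} → v ∈ xs → P v) → v ∈ xs → ReachIn G P s v
      from-head [ _ ]ʷ  P-on (here refl) = here (P-on (here refl))
      from-head (_ ▸ _) P-on (here refl) = here (P-on (here refl))
      from-head (e ▸ W) P-on (there v∈)  = step (P-on (here refl)) e (from-head W (P-on ∘ there) v∈)

  leaving-edge : ∀ {P} → ReachIn G P u v → u ∈ xs → v ∉ xs → ∃₂ λ y z → y ∈ xs × z ∉ xs × y ∼ z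
  leaving-edge (here _) u∈xs u∉xs = ⊥-elim (u∉xs u∈xs)
  leaving-edge {xs = xs} (step {w = w} _ u∼w r) u∈xs v∉xs with w ∈? xs
  ... | yes w∈xs = leaving-edge r w∈xs v∉xs
  ... | no  w∉xs = _ , _ , u∈xs , w∉xs , u∼w

  ∈⇒NonEmpty : v ∈ xs → NonEmpty G xs
  ∈⇒NonEmpty (here _)  = tt
  ∈⇒NonEmpty (there _) = tt

  pairwise-adjacent⇒Chain : (∀ {u v} → u ∈ xs → v ∈ xs → u ≢ v → u ∼ v) → Unique xs → Chain G xs
  pairwise-adjacent⇒Chain {[]}         _   _          = tt
  pairwise-adjacent⇒Chain {_ ∷ []}     _   _          = tt
  pairwise-adjacent⇒Chain {_ ∷ _ ∷ _}  adj (u≢ ∷ xs!) =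
    adj (here refl) (there (here refl)) (All.head u≢) ,
    pairwise-adjacent⇒Chain (λ u∈ v∈ → adj (there u∈) (there v∈)) xs!

  three-separated⇒¬TwoComponents : u ≢ x → v ≢ x → w ≢ x →
    ¬ ReachIn G (Minus G x) u v → ¬ ReachIn G (Minus G x) u w → ¬ ReachIn G (Minus G x) v w →
    ¬ TwoComponentsMinus G x
  three-separated⇒¬TwoComponents u≢x v≢x w≢x ¬uv ¬uw ¬vw (_ , _ , _ , _ , _ , cover)
    with cover _ u≢x | cover _ v≢x | cover _ w≢x
  ... | inj₁ ru | inj₁ rv | _       = ¬uv (reach-common ru rv)
  ... | inj₂ ru | inj₂ rv | _       = ¬uv (reach-common ru rv)
  ... | inj₁ ru | inj₂ _  | inj₁ rw = ¬uw (reach-common ru rw)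
  ... | inj₂ ru | inj₁ _  | inj₂ rw = ¬uw (reach-common ru rw)
  ... | inj₁ _  | inj₂ rv | inj₂ rw = ¬vw (reach-common rv rw)
  ... | inj₂ _  | inj₁ rv | inj₁ rw = ¬vw (reach-common rv rw)

  -- Hamiltonian paths

  ArticulationsSplitInTwo : Set
  ArticulationsSplitInTwo = ∀ x → Articulation G x → TwoComponentsMinus G x

  NoArticulationTriangle : Set
  NoArticulationTriangle = ∀ x y z → x ∼ y → y ∼ z → x ∼ z →
    Articulation G x → Articulation G y → Articulation G z → ⊥

  record HamPath (s t : V) (p : List V) : Set where
    field
      walk   : Walk s t p
      unique : Unique p
      covers : ∀ v → v ∈ p

  HamPath-reverse : ∀ {p} → HamPath s t p → HamPath t s (reverse p)
  HamPath-reverse {p = p} H = record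
    { walk   = reverseʷ walk
    ; unique = Unique-resp-↭ (↭-sym (↭-reverse p)) unique
    ; covers = reverse⁺ ∘ covers
    }
    where open HamPath H

  module _ {s t} (A : List V) {y} (C : List V) (H : HamPath s t (A ++ y ∷ C)) where
    open HamPath H

    sides : v ≢ y → v ∈ A ⊎ v ∈ C
    sides v≢y with ∈-++⁻ A (covers _)
    ... | inj₁ v∈A         = inj₁ v∈A
    ... | inj₂ (here v≡y)  = ⊥-elim (v≢y v≡y)
    ... | inj₂ (there v∈C) = inj₂ v∈C

    left≢ : v ∈ A → v ≢ y
    left≢ v∈A = Unique-++⇒≢ A unique v∈A (here refl)

    right≢ : v ∈ C → v ≢ y
    right≢ v∈C refl = Unique[x∷xs]⇒x∉xs (Unique-++⁻ʳ A unique) v∈C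

    left-reach : u ∈ A → v ∈ A → ReachIn G (Minus G y) u v
    left-reach u∈A v∈A = let _ , W = prefixʷ A walk u∈A in walk-reach W left≢ u∈A v∈A

    right-reach : u ∈ C → v ∈ C → ReachIn G (Minus G y) u v
    right-reach u∈C v∈C = let _ , W = suffixʷ (y ∷ []) C (dropʷ A walk) u∈C in walk-reach W right≢ u∈C v∈C

    articulation-sides : Articulation G y → ∃₂ λ a c → a ∈ A × c ∈ C × ¬ ReachIn G (Minus G y) a c
    articulation-sides (u , v , u≢y , v≢y , ¬uv) with sides u≢y | sides v≢y
    ... | inj₁ u∈A | inj₁ v∈A = ⊥-elim (¬uv (left-reach u∈A v∈A))
    ... | inj₂ u∈C | inj₂ v∈C = ⊥-elim (¬uv (right-reach u∈C v∈C))
    ... | inj₁ u∈A | inj₂ v∈C = u , v , u∈A , v∈C , ¬uv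
    ... | inj₂ u∈C | inj₁ v∈A = v , u , v∈A , u∈C , ¬uv ∘ reach-sym

    no-edge-across : Articulation G y → u ∈ A → v ∈ C → ¬ u ∼ v
    no-edge-across art u∈A v∈C u∼v with a , c , a∈A , c∈C , ¬ac ← articulation-sides art =
      ¬ac (reach-trans (left-reach a∈A u∈A) (step (left≢ u∈A) u∼v (right-reach v∈C c∈C)))

    two-components : Articulation G y → TwoComponentsMinus G y
    two-components art with a , c , a∈A , c∈C , ¬ac ← articulation-sides art =
      a , c , left≢ a∈A , right≢ c∈C , ¬ac ,
      λ v v≢y → [ inj₁ ∘ left-reach a∈A , inj₂ ∘ right-reach c∈C ] (sides v≢y)

  Hamiltonian⇒two-components : ∀ {p} → HamPath s t p → Articulation G y → TwoComponentsMinus G y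
  Hamiltonian⇒two-components {y = y} H art with A , C , refl ← ∈-∃++ (HamPath.covers H y) =
    two-components A C H art

  private
    -- v lies between u and x on the path, so as an articulation point it separates them.
    inner-cut : ∀ B D E C → HamPath s t ((B ++ u ∷ D ++ v ∷ E) ++ x ∷ C) → u ∼ x → Articulation G v → ⊥
    inner-cut B D E C H u∼x art =
      no-edge-across (B ++ _ ∷ D) (E ++ _ ∷ C) (subst (HamPath _ _) regroup H) art
        (∈-++⁺ʳ B (here refl)) (∈-++⁺ʳ E (here refl)) u∼x
      where
      open ++-Solver using (solve; _⊜_; _⊕_)
      regroup = solve 6 (λ B u D v E xC → (B ⊕ (u ⊕ (D ⊕ (v ⊕ E)))) ⊕ xC ⊜ (B ⊕ (u ⊕ D)) ⊕ (v ⊕ (E ⊕ xC)))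
                        refl B (_ ∷ []) D (_ ∷ []) E (_ ∷ C)

    same-side : ∀ A C → HamPath s t (A ++ x ∷ C) → y ∈ A → z ∈ A → y ≢ z → y ∼ x → z ∼ x →
      Articulation G y → Articulation G z → ⊥
    same-side A C H y∈A z∈A y≢z y∼x z∼x art-y art-z with ∈-∈-∃++ y∈A z∈A y≢z
    ... | B , D , E , inj₁ refl = inner-cut B D E C H y∼x art-z
    ... | B , D , E , inj₂ refl = inner-cut B D E C H z∼x art-y

  Hamiltonian⇒no-articulation-triangle : ∀ {p} → HamPath s t p → x ∼ y → y ∼ z → x ∼ z →
    Articulation G x → Articulation G y → Articulation G z → ⊥
  Hamiltonian⇒no-articulation-triangle {x = x} {y} {z} H x∼y y∼z x∼z art-x art-y art-z
    with A , C , refl ← ∈-∃++ (HamPath.covers H x)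
    with sides A C H (∼⇒≢ (∼-sym x∼y)) | sides A C H (∼⇒≢ (∼-sym x∼z))
  ... | inj₁ y∈A | inj₂ z∈C = no-edge-across A C H art-x y∈A z∈C y∼z
  ... | inj₂ y∈C | inj₁ z∈A = no-edge-across A C H art-x z∈A y∈C (∼-sym y∼z)
  ... | inj₁ y∈A | inj₁ z∈A = same-side A C H y∈A z∈A (∼⇒≢ y∼z) (∼-sym x∼y) (∼-sym x∼z) art-y art-z
  ... | inj₂ y∈C | inj₂ z∈C =
    same-side (reverse C) (reverse A) (subst (HamPath _ _) (reverse-++-∷ A x C) (HamPath-reverse H))
      (reverse⁺ y∈C) (reverse⁺ z∈C) (∼⇒≢ y∼z) (∼-sym x∼y) (∼-sym x∼z) art-y art-z

  Hamiltonian⇒conditions : HamiltonianPath G → ArticulationsSplitInTwo × NoArticulationTriangle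
  Hamiltonian⇒conditions (p , p-isPath , covers) with s , t , W ← IsPath⇒walk p-isPath =
    (λ _ → Hamiltonian⇒two-components H) , (λ _ _ _ → Hamiltonian⇒no-articulation-triangle H)
    where
    H : HamPath s t p
    H = record { walk = W ; unique = proj₁ (proj₂ p-isPath) ; covers = covers }

  -- Longest paths

  record Longest (s t : V) (q : List V) : Set where
    field
      walk    : Walk s t q
      unique  : Unique q
      maximal : ∀ {r} → IsPath G r → length r ≤ length q

  longest-path : V → ∃₂ λ s t → ∃ (Longest s t)
  longest-path v =
    let s , t , W = IsPath⇒walk best-isPath in
    s , t , best , record { walk = W ; unique = proj₁ (proj₂ best-isPath) ; maximal = maximal }
    where
    paths = filter IsPath? (listsOfLength≤ (allFin n) n)
    best  = argmax length (v ∷ []) paths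

    best-isPath : IsPath G best
    best-isPath = argmax-all length (tt , [] ∷ [] , tt)
      (All.tabulate (proj₂ ∘ ∈-filter⁻ IsPath? {xs = listsOfLength≤ (allFin n) n}))

    maximal : ∀ {r} → IsPath G r → length r ≤ length best
    maximal {r} r-isPath = All.lookup (f[xs]≤f[argmax] (v ∷ []) paths)
      (∈-filter⁺ IsPath? (∈-listsOfLength≤ ∈-allFin r (Unique⇒length≤ (proj₁ (proj₂ r-isPath)))) r-isPath)

  Longest-↭ : Longest s t q → Walk a b r → r ↭ q → Longest a b r
  Longest-↭ P W r↭q = record
    { walk    = W
    ; unique  = Unique-resp-↭ (↭-sym r↭q) (Longest.unique P)
    ; maximal = subst (_ ≤_) (sym (↭-length r↭q)) ∘ Longest.maximal P
    }

  Longest-reverse : Longest s t q → Longest t s (reverse q)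
  Longest-reverse {q = q} P = Longest-↭ P (reverseʷ (Longest.walk P)) (↭-reverse q)

  no-insertion : Longest s t q → Unique (u ∷ O ++ q) → Walk a b r → r ↭ u ∷ O ++ q → ⊥
  no-insertion {q = q} {O = O} {r = r} P uOq! W r↭uOq =
    <⇒≱ q<r (Longest.maximal P (walk⇒IsPath W (Unique-resp-↭ (↭-sym r↭uOq) uOq!)))
    where
    q<r : length q < length r
    q<r = subst (length q <_) (sym (↭-length r↭uOq))
            (s≤s (subst (length q ≤_) (sym (length-++ O)) (m≤n+m (length q) (length O))))

  outside≁head : Longest s t q → w ∉ q → ¬ w ∼ s
  outside≁head P w∉q w∼s = no-insertion {O = []} P (Unique-∷ w∉q (Longest.unique P)) (w∼s ▸ Longest.walk P) ↭-refl

  outside≁last : Longest s t q → w ∉ q → ¬ w ∼ t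
  outside≁last {q = q} P w∉q = outside≁head (Longest-reverse P) (∉-resp-↭ (↭-reverse q) w∉q)

  rotate : ∀ A {C} → Longest s t (A ++ a ∷ b ∷ C) → s ∼ b → Longest a t (a ∷ reverse A ++ b ∷ C)
  rotate A P s∼b =
    let W₁ , _ , W₂ = splitʷ A (Longest.walk P) in
    Longest-↭ P (subst (Walk _ _) (reverse-++ A (_ ∷ [])) (reverseʷ W₁) ⟨ s∼b ⟩ W₂) (↭-reverse-prefix A _ ↭-refl)

  head≁attachment-successor : ∀ A {C} → Longest s t (A ++ y ∷ b ∷ C) → w ∉ A ++ y ∷ b ∷ C → w ∼ y → ¬ s ∼ b
  head≁attachment-successor A P w∉q w∼y s∼b =
    outside≁head (rotate A P s∼b) (∉-resp-↭ (↭-reverse-prefix A _ ↭-refl) w∉q) w∼y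

  -- An edge s t closes q into a cycle, which reopens next to y as a longest path starting at y.
  head≁last : Longest s t q → w ∉ q → w ∼ y → y ∈ q → ¬ s ∼ t
  head≁last P w∉q w∼y y∈q with A , C , refl ← ∈-∃++ y∈q = closing-cycle A C P w∉q w∼y
    where
    closing-cycle : ∀ A C → Longest s t (A ++ y ∷ C) → w ∉ A ++ y ∷ C → w ∼ y → ¬ s ∼ t
    closing-cycle A []      P w∉q w∼y _   =
      outside≁last P w∉q (subst (_ ∼_) (sym (walk-single-last (dropʷ A (Longest.walk P)))) w∼y)
    closing-cycle A (c ∷ C) P w∉q w∼y s∼t =
      let W₁ , _ , W₂ = splitʷ A (Longest.walk P)
          cycle↭ = ↭-reverse-prefix A _ (↭-reverse (c ∷ C))
          cycle  = Longest-↭ P (subst (Walk _ _) (reverse-++ A (_ ∷ [])) (reverseʷ W₁) ⟨ s∼t ⟩ reverseʷ W₂) cycle↭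
      in outside≁head cycle (∉-resp-↭ cycle↭ w∉q) w∼y

  head≢last : Longest s t q → w ∉ q → w ∼ y → y ∈ q → s ≢ t
  head≢last P w∉q w∼y y∈q refl with closed-walk-single (Longest.walk P) (Longest.unique P)
  head≢last P w∉q w∼y (here refl) refl | refl = outside≁head P w∉q w∼y

  detour : ∀ A {C} → Longest s t (A ++ y ∷ z ∷ C) → Walk u v (u ∷ O) → Unique (u ∷ O ++ A ++ y ∷ z ∷ C) →
    y ∼ u → v ∼ z → ⊥
  detour {y = y} {z} {u} {O = O} A {C} P O-walk uOq! y∼u v∼z =
    let W₁ , _ , W₂ = splitʷ A (Longest.walk P) in
    no-insertion {O = O} P uOq! (W₁ ⟨ y∼u ⟩ O-walk ⟨ v∼z ⟩ W₂)
      (solve 4 (λ A y O zC → (A ⊕ y) ⊕ (O ⊕ zC) ⊜ O ⊕ (A ⊕ (y ⊕ zC))) ↭-refl A (y ∷ []) (u ∷ O) (z ∷ C))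
    where open ↭-Solver using (solve; _⊜_; _⊕_)

  record Attached (s t : V) (L : List V) (x : V) (R : List V) : Set where
    field
      longest    : Longest s t (L ++ x ∷ R)
      {o}        : V
      o∉         : o ∉ L ++ x ∷ R
      o∼x        : o ∼ x
    open Longest longest public

  Attached-↭ : ∀ {L′ R′} → Attached s t L x R → Longest a b (L′ ++ x ∷ R′) → L′ ++ x ∷ R′ ↭ L ++ x ∷ R →
    Attached a b L′ x R′
  Attached-↭ 𝒜 P perm = record { longest = P ; o∉ = ∉-resp-↭ perm (Attached.o∉ 𝒜) ; o∼x = Attached.o∼x 𝒜 }

  Attached-reverse : Attached s t L x R → Attached t s (reverse R) x (reverse L)
  Attached-reverse {L = L} {x = x} {R = R} 𝒜 =
    Attached-↭ 𝒜 (subst (Longest _ _) (reverse-++-∷ L x R) (Longest-reverse longest))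
      (↭-trans (↭-reflexive (sym (reverse-++-∷ L x R))) (↭-reverse (L ++ x ∷ R)))
    where open Attached 𝒜

  head∈left : Attached s t L x R → s ∈ L
  head∈left {L = []}    𝒜 = ⊥-elim (outside≁head longest o∉ (subst (_ ∼_) (sym (walk-head≡ walk)) o∼x))
    where open Attached 𝒜
  head∈left {L = _ ∷ _} 𝒜 = here (walk-head≡ (Attached.walk 𝒜))

  head≁x-across-bridge : ∀ K → Attached s t (K ++ c ∷ []) x (d ∷ R) → c ∼ d → ¬ s ∼ x
  head≁x-across-bridge {c = c} {x = x} {d = d} {R = R} K 𝒜 c∼d s∼x =
    let W₁ , _ , W₂ = splitʷ K (subst (Walk _ _) (++-assoc K (c ∷ []) (x ∷ d ∷ R)) walk) in
    no-insertion {O = []} longest (Unique-∷ o∉ unique) (o∼x ▸ ∼-sym s∼x ▸ (W₁ ⟨ c∼d ⟩ dropʷ (x ∷ []) W₂))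
      (↭-prep _ (↭-sym (shift x (K ++ c ∷ []) (d ∷ R))))
    where open Attached 𝒜

  Hamiltonian-or-Attached : Connected G → HamiltonianPath G ⊎ ∃[ s ] ∃[ t ] ∃[ L ] ∃[ x ] ∃[ R ] Attached s t L x R
  Hamiltonian-or-Attached (v₀ , connected)
    with s , t , q , P ← longest-path v₀
    with any? (λ v → ¬? (v ∈? q))
  ... | no ¬outside =
    inj₁ (q , walk⇒IsPath (Longest.walk P) (Longest.unique P) ,
          λ v → decidable-stable (v ∈? q) (¬outside ∘ (v ,_)))
  ... | yes (w , w∉q)
    with y , z , y∈q , z∉q , y∼z ← leaving-edge (connected s w) (walk-head∈ (Longest.walk P)) w∉q
    with L , R , refl ← ∈-∃++ y∈q
    = inj₂ (s , t , L , y , R , record { longest = P ; o∉ = z∉q ; o∼x = ∼-sym y∼z })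

  -- Longest paths in 4K₁-free graphs

  module _ (free : FourK1Free G) where

    FourK1Free⇒∼ : a ≢ b → a ≢ c → a ≢ d → b ≢ c → b ≢ d → c ≢ d →
      ¬ a ∼ b → ¬ a ∼ c → ¬ a ∼ d → ¬ b ∼ c → ¬ b ∼ d → c ∼ d
    FourK1Free⇒∼ a≢b a≢c a≢d b≢c b≢d c≢d a≁b a≁c a≁d b≁c b≁d = decidable-stable (_ ∼? _) λ c≁d →
      free (_ , _ , _ , _ , a≢b , a≢c , a≢d , b≢c , b≢d , c≢d , a≁b , a≁c , a≁d , b≁c , b≁d , c≁d)

    outside-clique : Longest s t q → w ∉ q → w ∼ y → y ∈ q → u ∉ q → v ∉ q → u ≢ v → u ∼ v
    outside-clique P w∉q w∼y y∈q u∉q v∉q u≢v =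
      FourK1Free⇒∼ (head≢last P w∉q w∼y y∈q) (∈∉⇒≢ s∈q u∉q) (∈∉⇒≢ s∈q v∉q) (∈∉⇒≢ t∈q u∉q) (∈∉⇒≢ t∈q v∉q) u≢v
        (head≁last P w∉q w∼y y∈q) (outside≁head P u∉q ∘ ∼-sym) (outside≁head P v∉q ∘ ∼-sym)
        (outside≁last P u∉q ∘ ∼-sym) (outside≁last P v∉q ∘ ∼-sym)
      where
      s∈q = walk-head∈ (Longest.walk P)
      t∈q = walk-last∈ (Longest.walk P)

    ends-dominate : Longest s t q → w ∉ q → w ∼ y → y ∈ q → v ∈ q → v ≢ s → v ≢ t → ¬ w ∼ v → s ∼ v ⊎ t ∼ v
    ends-dominate {s = s} {t = t} {v = v} P w∉q w∼y y∈q v∈q v≢s v≢t w≁v = dominate (t ∼? v)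
      where
      s∈q = walk-head∈ (Longest.walk P)
      t∈q = walk-last∈ (Longest.walk P)
      dominate : Dec (t ∼ v) → s ∼ v ⊎ t ∼ v
      dominate (yes t∼v) = inj₂ t∼v
      dominate (no  t≁v) = inj₁ (FourK1Free⇒∼
        (≢-sym (∈∉⇒≢ t∈q w∉q)) (≢-sym (∈∉⇒≢ s∈q w∉q)) (≢-sym (∈∉⇒≢ v∈q w∉q))
        (≢-sym (head≢last P w∉q w∼y y∈q)) (≢-sym v≢t) (≢-sym v≢s)
        (outside≁last P w∉q) (outside≁head P w∉q) w≁v (head≁last P w∉q w∼y y∈q ∘ ∼-sym) t≁v)

    outside-link : Longest s t q → w ∉ q → w ∼ y → y ∈ q → u ∉ q → v ∉ q →
      ∃[ O ] (Walk u v (u ∷ O) × Unique (u ∷ O ++ q))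
    outside-link {u = u} {v = v} P w∉q w∼y y∈q u∉q v∉q with u ≟ v
    ... | yes refl = [] , [ u ]ʷ , Unique-∷ u∉q (Longest.unique P)
    ... | no  u≢v  =
      v ∷ [] , outside-clique P w∉q w∼y y∈q u∉q v∉q u≢v ▸ [ v ]ʷ ,
      Unique-∷ (λ { (here u≡v) → u≢v u≡v ; (there u∈q) → u∉q u∈q }) (Unique-∷ v∉q (Longest.unique P))

    -- If the successor b of y is not z, then t ∼ b and s … y O z … t b … is longer than q.
    two-attachments : ∀ A B {C} → Longest s t (A ++ y ∷ B ++ z ∷ C) → Walk u v (u ∷ O) →
      Unique (u ∷ O ++ A ++ y ∷ B ++ z ∷ C) → y ∼ u → v ∼ z → ⊥
    two-attachments A []      P = detour A P
    two-attachments {s = s} {t = t} {y = y} {z = z} {u = u} {O = O} A (b ∷ B) {C} P O-walk uOq! y∼u v∼z =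
      no-insertion {O = O} P uOq! (to-y ⟨ y∼u ⟩ O-walk ⟨ v∼z ⟩ from-z ⟨ t∼b ⟩ b-segment)
        (solve 5 (λ A y O zC bB → (A ⊕ y) ⊕ (O ⊕ (zC ⊕ bB)) ⊜ O ⊕ (A ⊕ (y ⊕ (bB ⊕ zC))))
               ↭-refl A (y ∷ []) (u ∷ O) (z ∷ C) (b ∷ B))
      where
      open ↭-Solver using (solve; _⊜_; _⊕_)
      open Longest P
      split     = splitʷ A walk
      to-y      = proj₁ split
      after-y   = proj₂ (proj₂ split)
      b-segment = proj₂ (takeʷ B after-y)
      from-z    = dropʷ (b ∷ B) after-y

      u∉q : u ∉ A ++ y ∷ b ∷ B ++ z ∷ C
      u∉q = Unique[x∷xs]⇒x∉xs uOq! ∘ ∈-++⁺ʳ O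

      u≁b : ¬ u ∼ b
      u≁b u∼b = detour A P [ u ]ʷ (Unique-∷ u∉q unique) y∼u u∼b

      b≢t : b ≢ t
      b≢t = ≢-sym (∈∉⇒≢ (∈-++⁺ʳ B (walk-last∈ from-z))
                        (Unique[x∷xs]⇒x∉xs (Unique-++⁻ʳ (y ∷ []) (Unique-++⁻ʳ A unique))))

      t∼b : t ∼ b
      t∼b = [ ⊥-elim ∘ head≁attachment-successor A P u∉q (∼-sym y∼u) , id ]
              (ends-dominate P u∉q (∼-sym y∼u) (∈-++⁺ʳ A (here refl)) (∈-++⁺ʳ A (there (here refl)))
                (later≢head A walk unique (here refl)) b≢t u≁b)

    attachment-unique : Longest s t q → w ∉ q → w ∼ x → x ∈ q → u ∉ q → u ∼ y → y ∈ q → y ≡ x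
    attachment-unique {x = x} {y = y} P w∉q w∼x x∈q u∉q u∼y y∈q with y ≟ x
    ... | yes y≡x = y≡x
    ... | no  y≢x with ∈-∈-∃++ y∈q x∈q y≢x
    ... | A , B , C , inj₁ refl =
      let _ , O-walk , uOq! = outside-link P w∉q w∼x x∈q u∉q w∉q in
      ⊥-elim (two-attachments A B P O-walk uOq! (∼-sym u∼y) w∼x)
    ... | A , B , C , inj₂ refl =
      let _ , O-walk , wOq! = outside-link P w∉q w∼x x∈q w∉q u∉q in
      ⊥-elim (two-attachments A B P O-walk wOq! (∼-sym w∼x) u∼y)

    -- Rotating at b makes a an end of a longest path, so a ≁ t.
    predecessor-∼head : ∀ K {C} → Longest s t (K ++ a ∷ b ∷ C) → w ∉ K ++ a ∷ b ∷ C → w ∼ x → x ∈ K →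
      s ∼ b → s ∼ a
    predecessor-∼head {a = a} K P w∉q w∼x x∈K s∼b =
      [ id , ⊥-elim ∘ a≁t ∘ ∼-sym ] (ends-dominate P w∉q w∼x x∈q a∈q a≢s a≢t w≁a)
      where
      open Longest P
      x∈q = ∈-++⁺ˡ x∈K
      a∈q = ∈-++⁺ʳ K (here refl)
      a≢s = ≢-sym (Unique-++⇒≢ K unique (walk-head∈ (proj₂ (prefixʷ K walk x∈K))) (here refl))
      a≢t = ≢-sym (∈∉⇒≢ (walk-last∈ (proj₂ (proj₂ (splitʷ K walk)))) (Unique[x∷xs]⇒x∉xs (Unique-++⁻ʳ K unique)))
      w≁a = λ w∼a → Unique-++⇒≢ K unique x∈K (here refl) (sym (attachment-unique P w∉q w∼x x∈q w∉q w∼a a∈q))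
      rotated↭ = ↭-reverse-prefix K a ↭-refl
      a≁t = head≁last (rotate K P s∼b) (∉-resp-↭ rotated↭ w∉q) w∼x (∈-resp-↭ (↭-sym rotated↭) x∈q)

    attached-only-at-x : (𝒜 : Attached s t L x R) → u ∈ L ++ x ∷ R → v ∉ L ++ x ∷ R → u ∼ v → u ≡ x
    attached-only-at-x {L = L} 𝒜 u∈q v∉q u∼v =
      attachment-unique longest o∉ o∼x (∈-++⁺ʳ L (here refl)) v∉q (∼-sym u∼v) u∈q
      where open Attached 𝒜

    head≁right : Attached s t L x R → v ∈ R → ¬ s ∼ v
    head≁right {s = s} {t = t} {L = L} {x = x} {R = d ∷ R} 𝒜 v∈R =
      All.lookup (All¬-from-head {P = s ∼_} d R predecessor base) v∈R
      where
      open Attached 𝒜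
      base : ¬ s ∼ d
      base = head≁attachment-successor L longest o∉ o∼x
      predecessor : ∀ B a b C → d ∷ R ≡ B ++ a ∷ b ∷ C → s ∼ b → s ∼ a
      predecessor B a b C eq =
        predecessor-∼head (L ++ x ∷ B) (subst (Longest s t) regroup longest) (o∉ ∘ subst (_ ∈_) (sym regroup)) o∼x
          (∈-++⁺ʳ L (here refl))
        where regroup = trans (cong (λ R → L ++ x ∷ R) eq) (sym (++-assoc L (x ∷ B) (a ∷ b ∷ C)))

    last≁left : Attached s t L x R → v ∈ L → ¬ t ∼ v
    last≁left 𝒜 v∈L = head≁right (Attached-reverse 𝒜) (reverse⁺ v∈L)

    head∼left : Attached s t L x R → v ∈ L → v ≢ s → s ∼ v
    head∼left {L = L} 𝒜 v∈L v≢s =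
      [ id , ⊥-elim ∘ last≁left 𝒜 v∈L ]
        (ends-dominate longest o∉ o∼x (∈-++⁺ʳ L (here refl)) (∈-++⁺ˡ v∈L) v≢s (earlier≢last L walk unique v∈L) w≁v)
      where
      open Attached 𝒜
      w≁v = λ w∼v → Unique-++⇒≢ L unique v∈L (here refl) (attached-only-at-x 𝒜 (∈-++⁺ˡ v∈L) o∉ (∼-sym w∼v))

    rotate-left : ∀ Y {Z} → Attached s t (Y ++ u ∷ z ∷ Z) x R → Attached u t (u ∷ reverse Y ++ z ∷ Z) x R
    rotate-left {u = u} {z = z} {x = x} {R = R} Y {Z} 𝒜 =
      Attached-↭ 𝒜 (subst (Longest _ _) (sym regroupʳ) (rotate Y P s∼z))
        (↭-trans (↭-reflexive regroupʳ) (↭-trans (↭-reverse-prefix Y u ↭-refl) (↭-reflexive (sym regroup))))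
      where
      open Attached 𝒜
      regroup  = ++-assoc Y (u ∷ z ∷ Z) (x ∷ R)
      regroupʳ = cong (u ∷_) (++-assoc (reverse Y) (z ∷ Z) (x ∷ R))
      P   = subst (Longest _ _) regroup longest
      s∼z = head∼left 𝒜 (∈-++⁺ʳ Y (there (here refl)))
              (later≢head Y (Longest.walk P) (Longest.unique P) (here refl))

    left-inner-rotation : ∀ K → Attached s t (K ++ c ∷ []) x R → u ∈ K → ∃[ K′ ] Attached u t (K′ ++ c ∷ []) x R
    left-inner-rotation K 𝒜 u∈K with Y , Z , refl ← ∈-∃++ u∈K = to-front Y Z 𝒜
      where
      to-front : ∀ Y Z → Attached s t ((Y ++ u ∷ Z) ++ c ∷ []) x R → ∃[ K′ ] Attached u t (K′ ++ c ∷ []) x R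
      to-front {s = s} {t = t} {u = u} {c = c} {x = x} {R = R} Y []      𝒜 =
        u ∷ reverse Y , rotate-left Y (subst (λ L → Attached s t L x R) (++-assoc Y (u ∷ []) (c ∷ [])) 𝒜)
      to-front {s = s} {t = t} {u = u} {c = c} {x = x} {R = R} Y (z ∷ Z) 𝒜 =
        u ∷ reverse Y ++ z ∷ Z ,
        subst (λ L → Attached u t L x R) (sym (cong (u ∷_) (++-assoc (reverse Y) (z ∷ Z) (c ∷ []))))
          (rotate-left Y (subst (λ L → Attached s t L x R) (++-assoc Y (u ∷ z ∷ Z) (c ∷ [])) 𝒜))

    left-inner-neighbours : ∀ K → Attached s t (K ++ c ∷ []) x (d ∷ R) → c ∼ d → u ∈ K → u ∼ v → v ≢ c → v ∈ K
    left-inner-neighbours {c = c} {x = x} {d = d} {R = R} {v = v} K 𝒜 c∼d u∈K u∼v v≢c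
      with K′ , 𝒜′ ← left-inner-rotation K 𝒜 u∈K
      with v ∈? ((K ++ c ∷ []) ++ x ∷ d ∷ R)
    ... | no v∉q =
      ⊥-elim (Unique-++⇒≢ (K ++ c ∷ []) (Attached.unique 𝒜) (∈-++⁺ˡ u∈K) (here refl)
               (attached-only-at-x 𝒜 (∈-++⁺ˡ (∈-++⁺ˡ u∈K)) v∉q u∼v))
    ... | yes v∈q with ∈-++⁻ (K ++ c ∷ []) v∈q
    ... | inj₁ v∈Kc        = [ id , (λ { (here v≡c) → ⊥-elim (v≢c v≡c) }) ] (∈-++⁻ K v∈Kc)
    ... | inj₂ (here refl) = ⊥-elim (head≁x-across-bridge K′ 𝒜′ c∼d u∼v)
    ... | inj₂ (there v∈R) = ⊥-elim (head≁right 𝒜′ v∈R u∼v)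

    -- Rotations show that the vertices of K have no neighbours beyond c, so c separates s from t.
    bridge-end-articulation : ∀ K → Attached s t (K ++ c ∷ []) x (d ∷ R) → s ∈ K → c ∼ d → Articulation G c
    bridge-end-articulation {s = s} {t = t} {c = c} {x = x} {d = d} {R = R} K 𝒜 s∈K c∼d =
      s , t , Unique-++⇒≢ K q! s∈K (here refl) , ∈∉⇒≢ t∈xR (Unique[x∷xs]⇒x∉xs (Unique-++⁻ʳ K q!)) ,
      λ s⇝t → Unique-++⇒∉ K q! (reach-closed (_∈ K) closed s∈K s⇝t) (there t∈xR)
      where
      open Attached 𝒜
      q!   = subst Unique (++-assoc K (c ∷ []) (x ∷ d ∷ R)) unique
      t∈xR = walk-last∈ (dropʷ (K ++ c ∷ []) walk)
      closed : u ∈ K → v ≢ c → u ∼ v → v ∈ K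
      closed u∈K v≢c u∼v = left-inner-neighbours K 𝒜 c∼d u∈K u∼v v≢c

    outside-unreachable : (𝒜 : Attached s t L x R) → v ∈ L ++ x ∷ R → ¬ ReachIn G (Minus G x) (Attached.o 𝒜) v
    outside-unreachable {L = L} {x = x} {R = R} 𝒜 v∈q o⇝v =
      reach-closed (_∉ L ++ x ∷ R) (λ u∉q v≢x u∼v v∈q → v≢x (attached-only-at-x 𝒜 v∈q u∉q (∼-sym u∼v))) o∉ o⇝v v∈q
      where open Attached 𝒜

    attachment-articulation : Attached s t L x R → Articulation G x
    attachment-articulation {L = L} 𝒜 =
      o , _ , ≢-sym (∈∉⇒≢ (∈-++⁺ʳ L (here refl)) o∉) ,
      (λ s≡x → outside≁head longest o∉ (subst (_ ∼_) (sym s≡x) o∼x)) ,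
      outside-unreachable 𝒜 (walk-head∈ walk)
      where open Attached 𝒜

    cross-edge⇒left-end : Attached s t L x R → u ∈ L → v ∈ R → u ∼ v → ∃[ K ] (L ≡ K ++ u ∷ [] × s ∈ K)
    cross-edge⇒left-end 𝒜 u∈L v∈R u∼v with ∈-∃++ u∈L
    ... | Y     , _ ∷ _ , refl = ⊥-elim (head≁right (rotate-left Y 𝒜) v∈R u∼v)
    ... | []    , []    , refl = ⊥-elim (head≁right 𝒜 v∈R (subst (_∼ _) (sym (walk-head≡ (Attached.walk 𝒜))) u∼v))
    ... | y ∷ Y , []    , refl = y ∷ Y , refl , here (walk-head≡ (Attached.walk 𝒜))

    cross-edge⇒articulation-triangle : Attached s t L x R → u ∈ L → v ∈ R → u ∼ v →
      u ∼ x × x ∼ v × Articulation G u × Articulation G v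
    cross-edge⇒articulation-triangle {x = x} {R = R} {u = u} {v = v} 𝒜 u∈L v∈R u∼v
      with K , refl , s∈K ← cross-edge⇒left-end 𝒜 u∈L v∈R u∼v
      with K′ , rev≡ , t∈K′ ← cross-edge⇒left-end (Attached-reverse 𝒜) (reverse⁺ v∈R) (reverse⁺ u∈L) (∼-sym u∼v)
      with refl ← reverse-≡-∷ʳ {xs = R} rev≡ =
      proj₁ (proj₂ (splitʷ K (subst (Walk _ _) (++-assoc K (u ∷ []) (x ∷ v ∷ reverse K′)) (Attached.walk 𝒜)))) ,
      proj₁ (proj₂ (splitʷ (K ++ u ∷ []) (Attached.walk 𝒜))) ,
      bridge-end-articulation K 𝒜 s∈K u∼v ,
      bridge-end-articulation K′
        (subst₂ (λ L R → Attached _ _ L x R) rev≡ (reverse-++ K (u ∷ [])) (Attached-reverse 𝒜)) t∈K′ (∼-sym u∼v)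

    no-outside : Attached s t L x R → ArticulationsSplitInTwo → NoArticulationTriangle → ⊥
    no-outside {L = L} {x = x} {R = R} 𝒜 split no-triangle =
      three-separated⇒¬TwoComponents (≢-sym (∈∉⇒≢ (∈-++⁺ʳ L (here refl)) o∉))
        (λ s≡x → outside≁head longest o∉ (subst (_ ∼_) (sym s≡x) o∼x))
        (λ t≡x → outside≁last longest o∉ (subst (_ ∼_) (sym t≡x) o∼x))
        (outside-unreachable 𝒜 (walk-head∈ walk)) (outside-unreachable 𝒜 (walk-last∈ walk))
        (λ s⇝t → Unique-++⇒∉ L unique (reach-closed (_∈ L) closed (head∈left 𝒜) s⇝t) (walk-last∈ (dropʷ L walk)))
        (split x (attachment-articulation 𝒜))
      where
      open Attached 𝒜
      no-cross : u ∈ L → v ∈ R → ¬ u ∼ v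
      no-cross u∈L v∈R u∼v =
        let u∼x , x∼v , art-u , art-v = cross-edge⇒articulation-triangle 𝒜 u∈L v∈R u∼v
        in no-triangle _ _ _ u∼x x∼v u∼v art-u (attachment-articulation 𝒜) art-v
      closed : u ∈ L → v ≢ x → u ∼ v → v ∈ L
      closed {v = v} u∈L v≢x u∼v with v ∈? (L ++ x ∷ R)
      ... | no v∉q =
        ⊥-elim (Unique-++⇒≢ L unique u∈L (here refl) (attached-only-at-x 𝒜 (∈-++⁺ˡ u∈L) v∉q u∼v))
      ... | yes v∈q with ∈-++⁻ L v∈q
      ... | inj₁ v∈L         = v∈L
      ... | inj₂ (here v≡x)  = ⊥-elim (v≢x v≡x)
      ... | inj₂ (there v∈R) = ⊥-elim (no-cross u∈L v∈R u∼v)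

    Attached⇒PathCover2 : Attached s t L x R → PathCover2 G
    Attached⇒PathCover2 {L = L} {x = x} {R = R} 𝒜 =
      L ++ x ∷ R , rest , walk⇒IsPath walk unique , rest-isPath , (λ _ v∈q v∈rest → ∈rest⇒∉q v∈rest v∈q) , cover
      where
      open Attached 𝒜
      outside? : ∀ v → Dec (v ∉ L ++ x ∷ R)
      outside? v = ¬? (v ∈? (L ++ x ∷ R))
      rest  = filter outside? (allFin n)
      rest! = filter⁺ outside? (allFin⁺ n)
      ∈rest⇒∉q : v ∈ rest → v ∉ L ++ x ∷ R
      ∈rest⇒∉q = proj₂ ∘ ∈-filter⁻ outside? {xs = allFin n}
      rest-isPath : IsPath G rest
      rest-isPath = ∈⇒NonEmpty (∈-filter⁺ outside? (∈-allFin _) o∉) , rest! ,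
        pairwise-adjacent⇒Chain (λ u∈rest v∈rest → outside-clique longest o∉ o∼x (∈-++⁺ʳ L (here refl))
                                                      (∈rest⇒∉q u∈rest) (∈rest⇒∉q v∈rest)) rest!
      cover : ∀ v → v ∈ L ++ x ∷ R ⊎ v ∈ rest
      cover v with v ∈? (L ++ x ∷ R)
      ... | yes v∈q = inj₁ v∈q
      ... | no  v∉q = inj₂ (∈-filter⁺ outside? (∈-allFin v) v∉q)

    conditions⇒Hamiltonian : Connected G → ArticulationsSplitInTwo → NoArticulationTriangle → HamiltonianPath G
    conditions⇒Hamiltonian conn split no-triangle with Hamiltonian-or-Attached conn
    ... | inj₁ hamiltonian               = hamiltonian
    ... | inj₂ (_ , _ , _ , _ , _ , 𝒜) = ⊥-elim (no-outside 𝒜 split no-triangle)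

    ¬Hamiltonian⇒PathCover2 : Connected G → ¬ HamiltonianPath G → PathCover2 G
    ¬Hamiltonian⇒PathCover2 conn ¬hamiltonian with Hamiltonian-or-Attached conn
    ... | inj₁ hamiltonian               = ⊥-elim (¬hamiltonian hamiltonian)
    ... | inj₂ (_ , _ , _ , _ , _ , 𝒜) = Attached⇒PathCover2 𝒜

theorem11 : {n : ℕ} (G : Graph n) → Connected G → FourK1Free G →
    (HamiltonianPath G ⇔
      ((∀ x → Articulation G x → TwoComponentsMinus G x) ×
       (∀ x y z → Adj G x y → Adj G y z → Adj G x z →
          Articulation G x → Articulation G y → Articulation G z → ⊥)))
    × (¬ HamiltonianPath G → PathCover2 G)
theorem11 G conn free =
  mk⇔ Hamiltonian⇒conditions (λ (split , no-triangle) → conditions⇒Hamiltonian free conn split no-triangle) ,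
  ¬Hamiltonian⇒PathCover2 free conn
  where open Hamiltonicity G
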